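{- Let $T$ be a based scheme on $X$ (basepoint $x_*$), $U$ a based scheme on $Y$ (basepoint $y_*$), $\zeta$ an action of $U$ on $T$, $\tilde T=\{[1_Y,t]:t\in T\}$ (a closed subset of $U\ltimes_\zeta T$), and $\pi:U\ltimes_\zeta T\to (U\ltimes_\zeta T)/\!\!/\tilde T$ the natural quotient morphism. Define $i_Y:Y\to Y\times X$ by $y\mapsto(y,x_*)$. Then $i_Y$ defines a based morphism of schemes $i:U\to U\ltimes_\zeta T$, and the composition $i\pi$ is an isomorphism of schemes.
   Context: All schemes are association schemes on finite sets. Complex product $pq=\{r:a_{pqr}>0\}$; closed: $T^*T\subseteq T$; normal: $pT=Tp$ for all $p$. For closed $T$: $xT=\bigcup_{t\in T}xt$, $X/T=\{xT\}$, $s^T=\{(x_1T,x_2T):(x_1',x_2')\in s$ for some $x_i'\in x_iT\}$, $S/\!\!/T=\{s^T\}$, $\pi$ sends $x\mapsto xT$, $s\mapsto s^T$. A morphism of schemes is a map of underlying sets sending pairs in a common relation to pairs in a common relation; isomorphism if it and the induced map on relations are bijective. Based schemes carry a basepoint (quotients based at the coset of the basepoint); based morphisms preserve it. Category $\mathcal C$: for based $T$ on $X$, $U$ on $Y$, $\phi\in\mathrm{Hom}_{\mathcal C}(T,U)$ is $(T_\phi,U_\phi,\tilde\phi)$, $T_\phi,U_\phi$ normal closed in $T,U$, $\tilde\phi:T/\!\!/T_\phi\to U/\!\!/U_\phi$ a based isomorphism. Composition with $\psi\in\mathrm{Hom}_{\mathcal C}(U,V)$ ($V$ on $W$): $T_{\phi\psi}=\{t:\exists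 u,\ t^{T_\phi}\tilde\phi=u^{U_\phi},\ u^{U_\psi}\tilde\psi=1_W^{V_\psi}\}$, $V_{\phi\psi}=\{v:\exists u,\ 1_X^{T_\phi}\tilde\phi=u^{U_\phi},\ u^{U_\psi}\tilde\psi=v^{V_\psi}\}$, $(xT_{\phi\psi})\widetilde{\phi\psi}=wV_{\phi\psi}$ where $(xT_\phi)\tilde\phi=yU_\phi$, $(yU_\psi)\tilde\psi=wV_\psi$. $\mathrm{id}_T=(\{1_X\},\{1_X\},\mathrm{id})$. $\phi\le\psi$: $T_\phi\subseteq T_\psi$, $U_\phi\subseteq U_\psi$, $(xT_\phi)\tilde\phi\subseteq(xT_\psi)\tilde\psi$ for all $x$. $\phi^*\in\mathrm{Hom}_{\mathcal C}(U,T)$: same subsets, isomorphism $\tilde\phi^{ -1}$. $\tau=\tau_T$: the set $T$ with involution, distinguished $1=1_X$, constants $a_{pqr}$. A $\tau$-scheme: $(T',\alpha)$, $\alpha:\tau\to T'$ bijective, $1\alpha$ diagonal, $(p^*)\alpha=(p\alpha)^*$, $a_{(p\alpha)(q\alpha)(r\alpha)}=a_{pqr}$. For $\tau$-schemes $(T_1,\alpha),(T_2,\beta)$, $\phi\in\mathrm{Hom}_{\mathcal C}(T_1,T_2)$: $\phi(\tau)(P)=\{u:(t\alpha)^{(T_1)_\phi}\tilde\phi=(u\beta)^{(T_2)_\phi}$ for some $t\in P\}$. Action $\zeta$ of $U$ on $T$: $\tau$-schemes $\zeta_y=(T_y,\alpha^y)$ on $X$ ($y\in Y$) and $\zeta_{y_1}^{y_2}\in\mathrm{Hom}_{\mathcal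 C}(T_{y_1},T_{y_2})$ with (1) $T_{y_*}=T$, $\alpha^{y_*}=\mathrm{id}$; (2) $\zeta_y^y=\mathrm{id}$; (3) $\zeta_{y_2}^{y_1}=(\zeta_{y_1}^{y_2})^*$; (4) $\zeta_{y_1}^{y_2}(\tau)$ depends only on the $u\in U$ containing $(y_1,y_2)$; (5) $\zeta_{y_1}^{y_3}\le\zeta_{y_1}^{y_2}\zeta_{y_2}^{y_3}$. $T'_{y_1y_2}=(T_{y_1})_{\zeta_{y_1}^{y_2}}$, $T''_{y_1y_2}=(T_{y_2})_{\zeta_{y_1}^{y_2}}$. $[u,t]$ is the set of $((y_1,x_1),(y_2,x_2))$ with $(y_1,y_2)\in u$ and $((x_1T'_{y_1y_2})\tilde\zeta_{y_1}^{y_2},x_2T''_{y_1y_2})\in(t\alpha^{y_2})^{T''_{y_1y_2}}$; $U\ltimes_\zeta T=\{[u,t]\}$, a scheme on $Y\times X$ based at $(y_*,x_*)$. -}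

module Defs where

open import Data.Nat using (ℕ; _<_)
open import Data.Fin using (Fin)
open import Data.Fin.Properties using (_≟_)
open import Data.List using (length; filter; allFin)
open import Data.Product using (Σ; ∃; ∃-syntax; _×_; _,_; proj₁; proj₂)
open import Relation.Unary using (Decidable)
open import Relation.Nullary.Decidable using (_×-dec_)
open import Relation.Binary.PropositionalEquality using (_≡_)
open import Function.Bundles using (_⇔_)

count : ∀ {n} {P : Fin n → Set} → Decidable P → ℕ
count {n} P? = length (filter P? (allFin n))

-- The point set is Fin n, the relations are
-- indexed by Fin d, and  rel x y  is the (unique) relation containing
-- (x , y).

record IsScheme {n d : ℕ} (one : Fin d) (inv : Fin d → Fin d)
                (a : Fin d → Fin d → Fin d → ℕ)
                (rel : Fin n → Fin n → Fin d) : Set where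
  field
    nonempty : ∀ s → ∃[ x ] ∃[ y ] (rel x y ≡ s)
    diag→    : ∀ x y → rel x y ≡ one → x ≡ y
    →diag    : ∀ x → rel x x ≡ one
    inv-law  : ∀ x y → rel y x ≡ inv (rel x y)
    const    : ∀ p q r x y → rel x y ≡ r →
               count (λ z → (rel x z ≟ p) ×-dec (rel z y ≟ q)) ≡ a p q r

record BScheme : Set where
  field
    n d  : ℕ
    one  : Fin d
    inv  : Fin d → Fin d
    a    : Fin d → Fin d → Fin d → ℕ
    rel  : Fin n → Fin n → Fin d
    isScheme : IsScheme one inv a rel
    base : Fin n
open BScheme public

_∈Cx_·_ : (S : BScheme) → Fin (d S) → Fin (d S) → Fin (d S) → Set
(S ∈Cx p · q) r = 0 < a S p q r

record Closed (S : BScheme) (T : Fin (d S) → Set) : Set where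
  field
    inhabited : ∃[ t ] T t
    closure   : ∀ p q r → T p → T q → (S ∈Cx inv S p · q) r → T r

Normal : (S : BScheme) → (Fin (d S) → Set) → Set
Normal S T = ∀ p r → (∃[ t ] (T t × (S ∈Cx p · t) r)) ⇔ (∃[ t ] (T t × (S ∈Cx t · p) r))

NormalClosed : (S : BScheme) → (Fin (d S) → Set) → Set
NormalClosed S T = Closed S T × Normal S T

-- Relational structures (a point set and a family of relations given by
-- labels with a membership predicate).  Two labels denote the same
-- relation iff they have the same pairs.

record Struct : Set₁ where
  field
    Pt  : Set
    Lab : Set
    mem : Lab → Pt → Pt → Set

record QStruct : Set₁ where
  field
    Pt  : Set
    _≈_ : Pt → Pt → Set
    Lab : Set
    mem : Lab → Pt → Pt → Set

toStruct : BScheme → Struct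
toStruct S = record { Pt = Fin (n S) ; Lab = Fin (d S) ; mem = λ s x y → rel S x y ≡ s }

plain : Struct → QStruct
plain A = record { Pt = Struct.Pt A ; _≈_ = _≡_ ; Lab = Struct.Lab A ; mem = Struct.mem A }

InCoset : (A : Struct) → (Struct.Lab A → Set) → Struct.Pt A → Struct.Pt A → Set
InCoset A T x z = ∃[ t ] (T t × Struct.mem A t x z)

-- the quotient A // T : points x T (represented by x, equality = equality
-- of cosets), relations s^T
quot : (A : Struct) → (Struct.Lab A → Set) → QStruct
quot A T = record
  { Pt  = Struct.Pt A
  ; _≈_ = λ x y → ∀ z → InCoset A T x z ⇔ InCoset A T y z
  ; Lab = Struct.Lab A
  ; mem = λ s x y → ∃[ x′ ] ∃[ y′ ] (InCoset A T x x′ × InCoset A T y y′ × Struct.mem A s x′ y′)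
  }

Q : (S : BScheme) → (Fin (d S) → Set) → QStruct
Q S T = quot (toStruct S) T

module _ (A B : QStruct) (f : QStruct.Pt A → QStruct.Pt B) where
  private
    module A = QStruct A
    module B = QStruct B

  SameRelB : B.Lab → B.Lab → Set
  SameRelB s s′ = ∀ x y → B.mem s x y ⇔ B.mem s′ x y

  SameRelA : A.Lab → A.Lab → Set
  SameRelA s s′ = ∀ x y → A.mem s x y ⇔ A.mem s′ x y

  MapsInto : A.Lab → B.Lab → Set
  MapsInto s s′ = ∀ x y → A.mem s x y → B.mem s′ (f x) (f y)

  ImgEq : A.Lab → B.Lab → Set
  ImgEq s s′ = MapsInto s s′ ×
               (∀ z w → B.mem s′ z w → ∃[ x ] ∃[ y ] (A.mem s x y × f x B.≈ z × f y B.≈ w))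

  record IsMorphism : Set where
    field
      wellDef : ∀ x y → x A.≈ y → f x B.≈ f y
      rels    : ∀ s → ∃[ s′ ] MapsInto s s′

  record IsIso : Set where
    field
      morphism   : IsMorphism
      injective  : ∀ x y → f x B.≈ f y → x A.≈ y
      surjective : ∀ z → ∃[ x ] (f x B.≈ z)
      rel-functional : ∀ s s₁ s₂ → MapsInto s s₁ → MapsInto s s₂ → SameRelB s₁ s₂
      rel-injective  : ∀ s₁ s₂ s′ → MapsInto s₁ s′ → MapsInto s₂ s′ → SameRelA s₁ s₂
      rel-surjective : ∀ s′ → ∃[ s ] MapsInto s s′

-- The category C.  A morphism T → U is (T_φ , U_φ , φ̃) with φ̃ a based
-- isomorphism T//T_φ → U//U_φ, given by a map of representatives.

record Hom (A B : BScheme) : Set₁ where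
  field
    TA    : Fin (d A) → Set
    TB    : Fin (d B) → Set
    TA-nc : NormalClosed A TA
    TB-nc : NormalClosed B TB
    map   : Fin (n A) → Fin (n B)
    iso   : IsIso (Q A TA) (Q B TB) map
    based : QStruct._≈_ (Q B TB) (map (base A)) (base B)
open Hom public

IsIdHom : {A : BScheme} → Hom A A → Set
IsIdHom {A} φ = (∀ t → TA φ t ⇔ (t ≡ one A)) × (∀ t → TB φ t ⇔ (t ≡ one A))
              × (∀ x → QStruct._≈_ (Q A (TB φ)) (map φ x) x)

IsDual : {A B : BScheme} → Hom A B → Hom B A → Set
IsDual {A} {B} φ ψ = (∀ t → TA ψ t ⇔ TB φ t) × (∀ t → TB ψ t ⇔ TA φ t)
                   × (∀ x → QStruct._≈_ (Q A (TA φ)) (map ψ (map φ x)) x)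
                   × (∀ y → QStruct._≈_ (Q B (TB φ)) (map φ (map ψ y)) y)

compTA : {A B C : BScheme} → Hom A B → Hom B C → Fin (d A) → Set
compTA {A} {B} {C} ψ χ t = ∃[ u ] (ImgEq (Q A (TA ψ)) (Q B (TB ψ)) (map ψ) t u
                                  × ImgEq (Q B (TA χ)) (Q C (TB χ)) (map χ) u (one C))

compTC : {A B C : BScheme} → Hom A B → Hom B C → Fin (d C) → Set
compTC {A} {B} {C} ψ χ v = ∃[ u ] (ImgEq (Q A (TA ψ)) (Q B (TB ψ)) (map ψ) (one A) u
                                  × ImgEq (Q B (TA χ)) (Q C (TB χ)) (map χ) u v)

LeComp : {A B C : BScheme} → Hom A C → Hom A B → Hom B C → Set
LeComp {A} {B} {C} φ ψ χ =
    (∀ t → TA φ t → compTA ψ χ t)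
  × (∀ v → TB φ v → compTC ψ χ v)
  × (∀ x z → InCoset (toStruct C) (TB φ) (map φ x) z
           → InCoset (toStruct C) (compTC ψ χ) (map χ (map ψ x)) z)

tauMap : {A B : BScheme} → Hom A B → (Fin (d A) → Set) → Fin (d B) → Set
tauMap {A} {B} φ P u = ∃[ t ] (P t × ImgEq (Q A (TA φ)) (Q B (TB φ)) (map φ) t u)

-- A τ-scheme (T′ , α) on X is encoded by the classifier
-- c : X → X → τ with  c x y = t  iff  (x , y) ∈ t α; the conditions on α
-- say exactly that c is a scheme with the structure constants of T.

τScheme : BScheme → Set
τScheme T = Σ (Fin (n T) → Fin (n T) → Fin (d T)) (IsScheme (one T) (inv T) (a T))

asScheme : (T : BScheme) → τScheme T → BScheme
asScheme T (c , isS) = record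
  { n = n T ; d = d T ; one = one T ; inv = inv T ; a = a T
  ; rel = c ; isScheme = isS ; base = base T }

record Action (U T : BScheme) : Set₁ where
  field
    ζ    : Fin (n U) → τScheme T
    hom  : ∀ y₁ y₂ → Hom (asScheme T (ζ y₁)) (asScheme T (ζ y₂))
    ax1  : ∀ x x′ → proj₁ (ζ (base U)) x x′ ≡ rel T x x′
    ax2  : ∀ y → IsIdHom (hom y y)
    ax3  : ∀ y₁ y₂ → IsDual (hom y₁ y₂) (hom y₂ y₁)
    ax4  : ∀ y₁ y₂ y₁′ y₂′ → rel U y₁ y₂ ≡ rel U y₁′ y₂′ →
           ∀ (P : Fin (d T) → Set) u → tauMap (hom y₁ y₂) P u ⇔ tauMap (hom y₁′ y₂′) P u
    ax5  : ∀ y₁ y₂ y₃ → LeComp (hom y₁ y₃) (hom y₁ y₂) (hom y₂ y₃)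
open Action public

Semidirect : (U T : BScheme) → Action U T → Struct
Semidirect U T ζa = record
  { Pt  = Fin (n U) × Fin (n T)
  ; Lab = Fin (d U) × Fin (d T)
  ; mem = λ { (u , t) (y₁ , x₁) (y₂ , x₂) →
      rel U y₁ y₂ ≡ u
      × QStruct.mem (Q (asScheme T (ζ ζa y₂)) (TB (hom ζa y₁ y₂)))
                    t (map (hom ζa y₁ y₂) x₁) x₂ }
  }

Ttilde : (U T : BScheme) → Fin (d U) × Fin (d T) → Set
Ttilde U T (u , t) = u ≡ one U

sdBase : (U T : BScheme) → Fin (n U) × Fin (n T)
sdBase U T = (base U , base T)

iY : (U T : BScheme) → Fin (n U) → Fin (n U) × Fin (n T)
iY U T y = (y , base T)

-- Idea: the T̃-coset of (y , x) in U ⋉_ζ T is the whole fibre {y} × X, because [1_Y , t]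
-- only relates points over the same y.  So the quotient by T̃ is a copy of Y, and a
-- quotient relation [u , t]^T̃ links two fibres exactly when their base points lie in u,
-- whatever t is: every t is realised between the image under ζ_{y₁}^{y₂} of some point of
-- the first fibre and any given point of the second.  Hence i_Y π is bijective on points
-- and [u , t]^T̃ is the image of u.
module Submission where

open import Defs
open import Data.Fin using (Fin)
open import Data.Fin.Properties using (any?; _≟_)
open import Data.List using ([]; length; filter; allFin)
open import Data.List.Properties using (filter-some; filter-none)
open import Data.List.Membership.Propositional.Properties using (∈-allFin)
import Data.List.Relation.Unary.All as All
import Data.List.Relation.Unary.Any as Any
open import Data.Nat using (_<_)
open import Data.Product using (_×_; _,_; proj₁; ∃; ∃-syntax)
open import Function.Bundles using (_⇔_; mk⇔; Equivalence)
open import Relation.Binary.PropositionalEquality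
  using (_≡_; refl; sym; trans; cong; subst; subst₂)
open import Relation.Nullary using (yes; no; contradiction)
open import Relation.Nullary.Decidable using (_×-dec_)
open import Relation.Unary using (Decidable)

open Equivalence using (to; from)

module _ {m} {P : Fin m → Set} (P? : Decidable P) where

  count-pos : ∀ x → P x → 0 < count P?
  count-pos x px = filter-some P? (Any.map (λ { refl → px }) (∈-allFin x))

  count-pos⇒∃ : 0 < count P? → ∃ P
  count-pos⇒∃ pos with any? P?
  ... | yes ∃P = ∃P
  ... | no ¬∃P = contradiction (subst (λ xs → 0 < length xs) count≡[] pos) λ ()
    where
    count≡[] : filter P? (allFin m) ≡ []
    count≡[] = filter-none P? (All.universal (λ x px → ¬∃P (x , px)) (allFin m))

module SchemeProperties (S : BScheme) where
  open IsScheme (isScheme S)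

  -- a_{t* t 1} counts the z with (z , y) ∈ t; a pair witnessing that t is nonempty supplies one.
  one∈inv-t·t : ∀ t → (S ∈Cx inv S t · t) (one S)
  one∈inv-t·t t with nonempty t
  ... | x , y , xty = subst (0 <_) (const (inv S t) t (one S) y y (→diag y))
                        (count-pos _ x (trans (inv-law x y) (cong (inv S) xty) , xty))

  rel-into : ∀ t y → ∃[ x ] rel S x y ≡ t
  rel-into t y with count-pos⇒∃ (λ x → (rel S y x ≟ inv S t) ×-dec (rel S x y ≟ t))
                       (subst (0 <_) (sym (const _ _ _ y y (→diag y))) (one∈inv-t·t t))
  ... | x , _ , xty = x , xty

  closed⇒one : ∀ {P} → Closed S P → P (one S)
  closed⇒one cl with Closed.inhabited cl
  ... | t , Pt = Closed.closure cl t t (one S) Pt Pt (one∈inv-t·t t)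

  coset-refl : ∀ {P} → Closed S P → ∀ x → InCoset (toStruct S) P x x
  coset-refl cl x = one S , closed⇒one cl , →diag x

  quot-mem-rel : ∀ {P} → Closed S P → ∀ x y → QStruct.mem (Q S P) (rel S x y) x y
  quot-mem-rel cl x y = x , y , coset-refl cl x , coset-refl cl y , refl

open SchemeProperties using (rel-into; coset-refl; quot-mem-rel)

module _ {A B : BScheme} (φ : Hom A B) where
  private
    TB-closed : Closed B (TB φ)
    TB-closed = proj₁ (TB-nc φ)

  quot-mem-from-image : ∀ t y → ∃[ x ] QStruct.mem (Q B (TB φ)) t (map φ x) y
  quot-mem-from-image t y with rel-into B t y
  ... | y′ , y′ty with IsIso.surjective (iso φ) y′
  ... | x , φx≈y′ = x , y′ , y , from (φx≈y′ y′) (coset-refl B TB-closed y′)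
                        , coset-refl B TB-closed y , y′ty

  quot-mem-based : QStruct.mem (Q B (TB φ)) (one B) (map φ (base A)) (base B)
  quot-mem-based = base B , base B , from (based φ (base B)) (coset-refl B TB-closed (base B))
                 , coset-refl B TB-closed (base B) , IsScheme.→diag (isScheme B) (base B)

module SemidirectQuotient (T U : BScheme) (act : Action U T) where
  open IsScheme (isScheme U) using (diag→; →diag)

  private
    SD : Struct
    SD = Semidirect U T act

    SD/T̃ : QStruct
    SD/T̃ = quot SD (Ttilde U T)

    fibreClosed : ∀ y₁ y₂ → Closed (asScheme T (ζ act y₂)) (TB (hom act y₁ y₂))
    fibreClosed y₁ y₂ = proj₁ (TB-nc (hom act y₁ y₂))

  Ttilde-coset : ∀ y x y′ x′ → InCoset SD (Ttilde U T) (y , x) (y′ , x′) ⇔ y ≡ y′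
  Ttilde-coset y x y′ x′ = mk⇔
    (λ { (_ , u≡1 , yuy′ , _) → diag→ y y′ (trans yuy′ u≡1) })
    (λ { refl → (one U , _) , refl , →diag y
                , quot-mem-rel (asScheme T (ζ act y)) (fibreClosed y y) _ x′ })

  same-fibre⇒≈ : ∀ {y x y′ x′} → y ≡ y′ → QStruct._≈_ SD/T̃ (y , x) (y′ , x′)
  same-fibre⇒≈ {y} {x} {y′} {x′} refl (z , w) =
    mk⇔ (λ c → from (Ttilde-coset y x′ z w) (to (Ttilde-coset y x z w) c))
        (λ c → from (Ttilde-coset y x z w) (to (Ttilde-coset y x′ z w) c))

  quot-mem⇔ : ∀ u t y₁ x₁ y₂ x₂ → QStruct.mem SD/T̃ (u , t) (y₁ , x₁) (y₂ , x₂) ⇔ rel U y₁ y₂ ≡ u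
  quot-mem⇔ u t y₁ x₁ y₂ x₂ = mk⇔
    (λ { ((y₁′ , _) , (y₂′ , _) , c₁ , c₂ , y₁′uy₂′ , _) →
           subst₂ (λ a b → rel U a b ≡ u) (sym (to (Ttilde-coset _ _ _ _) c₁))
                  (sym (to (Ttilde-coset _ _ _ _) c₂)) y₁′uy₂′ })
    (λ y₁uy₂ → let (x₁′ , m) = quot-mem-from-image (hom act y₁ y₂) t x₂ in
       (y₁ , x₁′) , (y₂ , x₂) , from (Ttilde-coset _ _ _ _) refl
       , from (Ttilde-coset _ _ _ _) refl , y₁uy₂ , m)

  iY-morphism : IsMorphism (plain (toStruct U)) (plain SD) (iY U T)
  iY-morphism = record
    { wellDef = λ { _ _ refl → refl }
    ; rels    = λ s → (s , one T) , λ y₁ y₂ y₁sy₂ → y₁sy₂ , quot-mem-based (hom act y₁ y₂)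
    }

  private
    MapsInto/T̃ : Fin (d U) → Fin (d U) × Fin (d T) → Set
    MapsInto/T̃ = MapsInto (plain (toStruct U)) SD/T̃ (iY U T)

  mapsInto⇒≡ : ∀ s u t → MapsInto/T̃ s (u , t) → s ≡ u
  mapsInto⇒≡ s u t s↦ut with IsScheme.nonempty (isScheme U) s
  ... | y₁ , y₂ , y₁sy₂ = trans (sym y₁sy₂) (to (quot-mem⇔ u t _ _ _ _) (s↦ut y₁ y₂ y₁sy₂))

  mapsInto-same-label : ∀ {s s′ u t u′ t′} → MapsInto/T̃ s (u , t) → MapsInto/T̃ s′ (u′ , t′)
                      → s ≡ s′ ⇔ u ≡ u′
  mapsInto-same-label {s} {s′} {u} {t} {u′} {t′} s↦ut s′↦u′t′
    rewrite mapsInto⇒≡ s u t s↦ut | mapsInto⇒≡ s′ u′ t′ s′↦u′t′ = mk⇔ (λ e → e) (λ e → e)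

  iYπ-iso : IsIso (plain (toStruct U)) SD/T̃ (iY U T)
  iYπ-iso = record
    { morphism = record
      { wellDef = λ _ _ → same-fibre⇒≈
      ; rels    = λ s → (s , one T) , λ y₁ y₂ → from (quot-mem⇔ s (one T) y₁ _ y₂ _)
      }
    ; injective  = λ y y′ iYy≈iYy′ →
        sym (to (Ttilde-coset y′ _ y _) (to (iYy≈iYy′ (y , base T)) (from (Ttilde-coset y _ y _) refl)))
    ; surjective = λ { (y , x) → y , same-fibre⇒≈ refl }
    ; rel-functional = λ { s (u , t) (u′ , t′) s↦ut s↦u′t′ (y₁ , x₁) (y₂ , x₂) →
        let u≡u′ = to (mapsInto-same-label s↦ut s↦u′t′) refl in
        mk⇔ (λ m → from (quot-mem⇔ u′ t′ y₁ x₁ y₂ x₂) (trans (to (quot-mem⇔ u t y₁ x₁ y₂ x₂) m) u≡u′))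
            (λ m → from (quot-mem⇔ u t y₁ x₁ y₂ x₂) (trans (to (quot-mem⇔ u′ t′ y₁ x₁ y₂ x₂) m) (sym u≡u′))) }
    ; rel-injective = λ s s′ ut s↦ut s′↦ut y₁ y₂ →
        let s≡s′ = from (mapsInto-same-label s↦ut s′↦ut) refl in
        mk⇔ (λ e → trans e s≡s′) (λ e → trans e (sym s≡s′))
    ; rel-surjective = λ { (u , t) → u , λ y₁ y₂ → from (quot-mem⇔ u t y₁ _ y₂ _) }
    }

proposition5p2 : (T U : BScheme) (ζ : Action U T) →
    (IsMorphism (plain (toStruct U)) (plain (Semidirect U T ζ)) (iY U T)
      × iY U T (base U) ≡ sdBase U T)
    × IsIso (plain (toStruct U)) (quot (Semidirect U T ζ) (Ttilde U T)) (iY U T)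
proposition5p2 T U ζ = (iY-morphism , refl) , iYπ-iso
  where open SemidirectQuotient T U ζ
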